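{- Let $E$ be a finite-dimensional vector space over a field and let $\mathrm{cl}:\mathcal{L}(E)\to\mathcal{L}(E)$ satisfy (Cl1)–(Cl4). Define $r_{\mathrm{cl}}(A):=\min\{\dim I: I\subseteq A,\ \mathrm{cl}(I)=\mathrm{cl}(A)\}$ for $A\in\mathcal{L}(E)$. Then $r_{\mathrm{cl}}$ satisfies (R1) $0\le r_{\mathrm{cl}}(A)\le\dim A$ for all $A$; (R2) $r_{\mathrm{cl}}(A)\le r_{\mathrm{cl}}(B)$ whenever $A\subseteq B$; (R3) $r_{\mathrm{cl}}(A+B)+r_{\mathrm{cl}}(A\cap B)\le r_{\mathrm{cl}}(A)+r_{\mathrm{cl}}(B)$ for all $A,B$.
   Context: $\mathcal{L}(E)$ is the lattice of subspaces of $E$. Closure axioms: (Cl1) $A\subseteq\mathrm{cl}(A)$; (Cl2) $A\subseteq B\Rightarrow\mathrm{cl}(A)\subseteq\mathrm{cl}(B)$; (Cl3) $\mathrm{cl}(\mathrm{cl}(A))=\mathrm{cl}(A)$; (Cl4) for all subspaces $A$ and $1$-dimensional $x,y$, if $y\subseteq\mathrm{cl}(A+x)$ and $y\not\subseteq\mathrm{cl}(A)$ then $x\subseteq\mathrm{cl}(A+y)$. -}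

module Defs where

open import Level using (Level; _⊔_) renaming (suc to lsuc)
open import Data.Nat using (ℕ; zero; suc) renaming (_+_ to _+ℕ_; _≤_ to _≤ℕ_)
open import Data.Fin using (Fin) renaming (zero to fzero; suc to fsuc)
open import Data.Product using (Σ; ∃; ∃-syntax; _×_; _,_)
open import Relation.Nullary using (¬_)
open import Algebra.Bundles using (CommutativeRing)

record Field (c ℓ : Level) : Set (lsuc (c ⊔ ℓ)) where
  field
    commutativeRing : CommutativeRing c ℓ
  open CommutativeRing commutativeRing public
  field
    1≉0     : ¬ (1# ≈ 0#)
    inverse : ∀ x → ¬ (x ≈ 0#) → ∃[ y ] (x * y ≈ 1#)

module VectorSpace {c ℓ : Level} (K : Field c ℓ) (n : ℕ) where
  open Field K

  Vec : Set c
  Vec = Fin n → Carrier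

  _≈ᵥ_ : Vec → Vec → Set ℓ
  u ≈ᵥ v = ∀ i → u i ≈ v i

  0ᵥ : Vec
  0ᵥ _ = 0#

  _+ᵥ_ : Vec → Vec → Vec
  (u +ᵥ v) i = u i + v i

  _·ᵥ_ : Carrier → Vec → Vec
  (a ·ᵥ v) i = a * v i

  lincomb : ∀ {d} → (Fin d → Carrier) → (Fin d → Vec) → Vec
  lincomb {zero}  a v = 0ᵥ
  lincomb {suc d} a v =
    (a fzero ·ᵥ v fzero) +ᵥ lincomb (λ i → a (fsuc i)) (λ i → v (fsuc i))

  record Subspace : Set (lsuc (c ⊔ ℓ)) where
    field
      _∋_      : Vec → Set (c ⊔ ℓ)
      resp     : ∀ {u v} → u ≈ᵥ v → _∋_ u → _∋_ v
      zero∈    : _∋_ 0ᵥ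
      +-closed : ∀ {u v} → _∋_ u → _∋_ v → _∋_ (u +ᵥ v)
      ·-closed : ∀ a {v} → _∋_ v → _∋_ (a ·ᵥ v)
  open Subspace public

  _⊆_ : Subspace → Subspace → Set (c ⊔ ℓ)
  A ⊆ B = ∀ v → A ∋ v → B ∋ v

  _≐_ : Subspace → Subspace → Set (c ⊔ ℓ)
  A ≐ B = (A ⊆ B) × (B ⊆ A)

  LinIndep : ∀ {d} → (Fin d → Vec) → Set (c ⊔ ℓ)
  LinIndep v = ∀ a → lincomb a v ≈ᵥ 0ᵥ → ∀ i → a i ≈ 0#

  HasDim : Subspace → ℕ → Set (c ⊔ ℓ)
  HasDim A d = Σ (Fin d → Vec) λ b →
                 (∀ i → A ∋ b i)
               × LinIndep b
               × (∀ v → A ∋ v → ∃[ a ] (v ≈ᵥ lincomb a b))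

  private
    +-swap : ∀ x y z w → ((x + y) + (z + w)) ≈ ((x + z) + (y + w))
    +-swap x y z w =
      trans (+-assoc x y _)
      (trans (+-congˡ (trans (sym (+-assoc y z w))
               (trans (+-congʳ (+-comm y z)) (+-assoc z y w))))
      (sym (+-assoc x z _)))

  _⊕_ : Subspace → Subspace → Subspace
  A ⊕ B = record
    { _∋_ = λ v → ∃[ a ] ∃[ b ] (A ∋ a × B ∋ b × v ≈ᵥ (a +ᵥ b))
    ; resp = λ { u≈v (a , b , a∈ , b∈ , e) →
                 a , b , a∈ , b∈ , λ i → trans (sym (u≈v i)) (e i) }
    ; zero∈ = 0ᵥ , 0ᵥ , zero∈ A , zero∈ B , λ i → sym (+-identityˡ 0#)
    ; +-closed = λ { (a , b , a∈ , b∈ , e) (a' , b' , a∈' , b∈' , e') →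
        (a +ᵥ a') , (b +ᵥ b') , +-closed A a∈ a∈' , +-closed B b∈ b∈'
        , λ i → trans (+-cong (e i) (e' i)) (+-swap (a i) (b i) (a' i) (b' i)) }
    ; ·-closed = λ { k (a , b , a∈ , b∈ , e) →
        (k ·ᵥ a) , (k ·ᵥ b) , ·-closed A k a∈ , ·-closed B k b∈
        , λ i → trans (*-congˡ (e i)) (distribˡ k (a i) (b i)) }
    }

  _∩_ : Subspace → Subspace → Subspace
  A ∩ B = record
    { _∋_ = λ v → A ∋ v × B ∋ v
    ; resp = λ { e (x , y) → resp A e x , resp B e y }
    ; zero∈ = zero∈ A , zero∈ B
    ; +-closed = λ { (x , y) (x' , y') → +-closed A x x' , +-closed B y y' }
    ; ·-closed = λ { k (x , y) → ·-closed A k x , ·-closed B k y }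
    }

  record IsClosure (cl : Subspace → Subspace) : Set (lsuc (c ⊔ ℓ)) where
    field
      Cl1 : ∀ A → A ⊆ cl A
      Cl2 : ∀ A B → A ⊆ B → cl A ⊆ cl B
      Cl3 : ∀ A → cl (cl A) ≐ cl A
      Cl4 : ∀ A x y → HasDim x 1 → HasDim y 1 →
            y ⊆ cl (A ⊕ x) → ¬ (y ⊆ cl A) → x ⊆ cl (A ⊕ y)

  IsRankCl : (Subspace → Subspace) → Subspace → ℕ → Set (lsuc (c ⊔ ℓ))
  IsRankCl cl A k =
      (∃[ I ] (I ⊆ A × cl I ≐ cl A × HasDim I k))
    × (∀ I d → I ⊆ A → cl I ≐ cl A → HasDim I d → k ≤ℕ d)

  R1 : (Subspace → ℕ) → Set (lsuc (c ⊔ ℓ))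
  R1 r = ∀ A d → HasDim A d → r A ≤ℕ d      -- 0 ≤ r A is automatic in ℕ

  R2 : (Subspace → ℕ) → Set (lsuc (c ⊔ ℓ))
  R2 r = ∀ A B → A ⊆ B → r A ≤ℕ r B

  R3 : (Subspace → ℕ) → Set (lsuc (c ⊔ ℓ))
  R3 r = ∀ A B → r (A ⊕ B) +ℕ r (A ∩ B) ≤ℕ r A +ℕ r B

{-# OPTIONS --safe #-}
module Submission where

-- Take a minimal list of vectors of A whose closed span contains A; its length is r A,
-- and minimality makes it cl-independent: no element lies in the closure of the span of
-- the others.  Cl4 yields the Steinitz exchange lemma for cl-independent lists: such a list
-- T inside cl(span R) can replace |T| elements of R without shrinking cl(span R).  Hence
-- r S ≤ |L| whenever S ⊆ cl(span L), which gives monotonicity, and extending a minimal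
-- list of A ∩ B once inside A and once inside B gives a list of length r A + r B - r (A ∩ B)
-- whose closed span contains A + B, which gives submodularity.  Membership in cl A is not
-- decidable, so the exchange argument runs in the double-negation monad; its conclusions
-- are inequalities between natural numbers, which are stable.

open import Defs
open import Level using (Level; _⊔_)
open import Function using (_∘_)
open import Data.Nat using (ℕ; zero; suc) renaming (_+_ to _+ℕ_; _≤_ to _≤ℕ_)
import Data.Nat.Properties as ℕ
open import Data.Nat.Tactic.RingSolver using (solve-∀)
open import Data.Fin using (Fin) renaming (zero to fzero; suc to fsuc)
open import Data.Product using (∃-syntax; _×_; _,_; proj₁; proj₂)
open import Data.Unit.Polymorphic using (⊤; tt)
open import Data.List using (List; []; _∷_; _++_; [_]; length; lookup)
open import Data.List.Properties using (length-++; ++-assoc; ++-identityʳ; length-tabulate)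
open import Data.List.Relation.Unary.All as All using (All; []; _∷_)
open import Data.List.Relation.Unary.All.Properties using (++⁺; anti-mono; tabulate⁺)
open import Data.List.Relation.Unary.Any using (here; there)
open import Data.List.Membership.Propositional using (_∈_)
open import Data.List.Membership.Propositional.Properties using (∈-++⁺ʳ; ∈-lookup)
open import Data.List.Relation.Binary.Subset.Propositional using () renaming (_⊆_ to _⊆ˡ_)
open import Data.List.Relation.Binary.Subset.Propositional.Properties
  using (⊆-reflexive; xs⊆x∷xs; ∷⁺ʳ; xs⊆xs++ys; xs⊆ys++xs; ++⁺ʳ)
import Data.Vec.Functional as Vector
open import Relation.Nullary using (¬_)
open import Relation.Nullary.Decidable using (yes; no; decidable-stable; ¬¬-excluded-middle)
import Relation.Binary.PropositionalEquality as ≡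
open ≡ using (_≡_)

private
  variable
    p q : Level
    A : Set p
    B : Set q

  return : A → ¬ ¬ A
  return x ¬x = ¬x x

  _>>=_ : ¬ ¬ A → (A → ¬ ¬ B) → ¬ ¬ B
  (m >>= f) ¬y = m (λ x → f x ¬y)

length-++-∷ : ∀ (xs : List A) {x} ys → length (xs ++ x ∷ ys) ≡ suc (length (xs ++ ys))
length-++-∷ []       ys = ≡.refl
length-++-∷ (_ ∷ xs) ys = ≡.cong suc (length-++-∷ xs ys)

counted-twice : ∀ p x y → (p +ℕ (x +ℕ y)) +ℕ p ≡ (p +ℕ x) +ℕ (p +ℕ y)
counted-twice = solve-∀

¬¬-first-prefix : (P : List A → Set p) (R : List A) → ¬ P [] → P R →
                  ¬ ¬ (∃[ R₁ ] ∃[ j ] ∃[ R₂ ] (R ≡ R₁ ++ j ∷ R₂ × ¬ P R₁ × P (R₁ ++ [ j ])))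
¬¬-first-prefix P []      ¬P[] P[] _ = ¬P[] P[]
¬¬-first-prefix P (j ∷ R) ¬P[] PjR = do
  no ¬Pj ← ¬¬-excluded-middle
    where yes Pj → return ([] , j , R , ≡.refl , ¬P[] , Pj)
  (R₁ , j′ , R₂ , R≡ , ¬PjR₁ , PjR₁j′) ← ¬¬-first-prefix (P ∘ (j ∷_)) R ¬Pj PjR
  return (j ∷ R₁ , j′ , R₂ , ≡.cong (j ∷_) R≡ , ¬PjR₁ , PjR₁j′)

module Span {c ℓ : Level} (K : Field c ℓ) (n : ℕ) where
  open Field K
  open VectorSpace K n
  open import Algebra.Properties.CommutativeSemigroup +-commutativeSemigroup using (interchange)

  symᵥ : ∀ {u v} → u ≈ᵥ v → v ≈ᵥ u
  symᵥ u≈v i = sym (u≈v i)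

  lincomb-0 : ∀ {d} (v : Fin d → Vec) → lincomb (λ _ → 0#) v ≈ᵥ 0ᵥ
  lincomb-0 {zero}  v i = refl
  lincomb-0 {suc d} v i = trans (+-cong (zeroˡ _) (lincomb-0 (v ∘ fsuc) i)) (+-identityˡ 0#)

  lincomb-+ : ∀ {d} (a b : Fin d → Carrier) (v : Fin d → Vec) →
              lincomb (λ i → a i + b i) v ≈ᵥ (lincomb a v +ᵥ lincomb b v)
  lincomb-+ {zero}  a b v i = sym (+-identityˡ 0#)
  lincomb-+ {suc d} a b v i =
    trans (+-cong (distribʳ _ _ _) (lincomb-+ (a ∘ fsuc) (b ∘ fsuc) (v ∘ fsuc) i))
          (interchange _ _ _ _)

  lincomb-· : ∀ {d} k (a : Fin d → Carrier) (v : Fin d → Vec) →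
              lincomb (λ i → k * a i) v ≈ᵥ (k ·ᵥ lincomb a v)
  lincomb-· {zero}  k a v i = sym (zeroʳ k)
  lincomb-· {suc d} k a v i =
    trans (+-cong (*-assoc _ _ _) (lincomb-· k (a ∘ fsuc) (v ∘ fsuc) i))
          (sym (distribˡ _ _ _))

  span : List Vec → Subspace
  span L = record
    { _∋_      = λ v → ∃[ a ] (v ≈ᵥ lincomb a (lookup L))
    ; resp     = λ { u≈v (a , u≈) → a , λ i → trans (sym (u≈v i)) (u≈ i) }
    ; zero∈    = (λ _ → 0#) , symᵥ (lincomb-0 (lookup L))
    ; +-closed = λ { (a , u≈) (b , v≈) →
        (λ i → a i + b i) , λ i → trans (+-cong (u≈ i) (v≈ i)) (sym (lincomb-+ a b _ i)) }
    ; ·-closed = λ { k (a , v≈) →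
        (λ i → k * a i) , λ i → trans (*-congˡ (v≈ i)) (sym (lincomb-· k a _ i)) }
    }

  line : Vec → Subspace
  line v = span [ v ]

  span-∋ : ∀ L {x} → x ∈ L → span L ∋ x
  span-∋ (x ∷ L) (here ≡.refl) =
    (1# Vector.∷ λ _ → 0#) ,
    λ i → sym (trans (+-cong (*-identityˡ _) (lincomb-0 (lookup L) i)) (+-identityʳ _))
  span-∋ (y ∷ L) (there x∈L) =
    let a , x≈ = span-∋ L x∈L
    in (0# Vector.∷ a) , λ i → trans (x≈ i) (sym (trans (+-congʳ (zeroˡ _)) (+-identityˡ _)))

  span-least : ∀ S {L} → All (S ∋_) L → span L ⊆ S
  span-least S []          v (a , v≈) = resp S (symᵥ v≈) (zero∈ S)
  span-least S (x∈S ∷ L⊆S) v (a , v≈) =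
    resp S (symᵥ v≈) (+-closed S (·-closed S (a fzero) x∈S)
                                 (span-least S L⊆S _ (a ∘ fsuc , λ i → refl)))

  span-mono : ∀ {L M} → L ⊆ˡ M → span L ⊆ span M
  span-mono {M = M} L⊆M = span-least (span M) (All.tabulate (λ x∈L → span-∋ M (L⊆M x∈L)))

  ⊕-least : ∀ {A B C} → A ⊆ C → B ⊆ C → (A ⊕ B) ⊆ C
  ⊕-least {C = C} A⊆C B⊆C v (a , b , a∈A , b∈B , v≈) =
    resp C (symᵥ v≈) (+-closed C (A⊆C a a∈A) (B⊆C b b∈B))

  span-++ : ∀ L M → span (L ++ M) ⊆ (span L ⊕ span M)
  span-++ L M = span-least (span L ⊕ span M) (++⁺ (All.tabulate inl) (All.tabulate inr))
    where
    inl : ∀ {x} → x ∈ L → (span L ⊕ span M) ∋ x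
    inl {x} x∈L = x , 0ᵥ , span-∋ L x∈L , zero∈ (span M) , λ i → sym (+-identityʳ _)
    inr : ∀ {x} → x ∈ M → (span L ⊕ span M) ∋ x
    inr {x} x∈M = 0ᵥ , x , zero∈ (span L) , span-∋ M x∈M , λ i → sym (+-identityˡ _)

  -- Constructively stronger than v ≉ 0ᵥ: it is what makes a line one-dimensional.
  Nonzero : Vec → Set (c ⊔ ℓ)
  Nonzero v = ∀ k → (k ·ᵥ v) ≈ᵥ 0ᵥ → k ≈ 0#

  Independent : List Vec → Set (c ⊔ ℓ)
  Independent []      = ⊤
  Independent (v ∷ L) = (∀ k w → span L ∋ w → ((k ·ᵥ v) +ᵥ w) ≈ᵥ 0ᵥ → k ≈ 0#) × Independent L

  independent-lookup : ∀ L → Independent L → LinIndep (lookup L)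
  independent-lookup (v ∷ L) (v-indep , L-indep) a Σ≈0 = a≈0
    where
    a₀≈0 : a fzero ≈ 0#
    a₀≈0 = v-indep (a fzero) _ (a ∘ fsuc , λ i → refl) Σ≈0
    rest≈0 : lincomb (a ∘ fsuc) (lookup L) ≈ᵥ 0ᵥ
    rest≈0 i = trans (sym (+-identityˡ _))
                     (trans (+-congʳ (sym (trans (*-congʳ a₀≈0) (zeroˡ _)))) (Σ≈0 i))
    a≈0 : ∀ i → a i ≈ 0#
    a≈0 fzero    = a₀≈0
    a≈0 (fsuc i) = independent-lookup L L-indep (a ∘ fsuc) rest≈0 i

  span-hasDim : ∀ L → Independent L → HasDim (span L) (length L)
  span-hasDim L L-indep =
    lookup L , (λ i → span-∋ L (∈-lookup i)) , independent-lookup L L-indep , λ v v∈ → v∈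

  independent-nonzero : ∀ L → Independent L → All Nonzero L
  independent-nonzero []      _                   = []
  independent-nonzero (v ∷ L) (v-indep , L-indep) =
    (λ k kv≈0 → v-indep k 0ᵥ (zero∈ (span L)) (λ i → trans (+-identityʳ _) (kv≈0 i)))
    ∷ independent-nonzero L L-indep

  line-hasDim : ∀ {v} → Nonzero v → HasDim (line v) 1
  line-hasDim {v} v≉0 = span-hasDim [ v ] (v-indep , tt)
    where
    v-indep : ∀ k w → span [] ∋ w → ((k ·ᵥ v) +ᵥ w) ≈ᵥ 0ᵥ → k ≈ 0#
    v-indep k w (_ , w≈0) kv+w≈0 =
      v≉0 k (λ i → trans (sym (+-identityʳ _)) (trans (+-congˡ (sym (w≈0 i))) (kv+w≈0 i)))

  independent-remove : ∀ Pre {a} Post → Independent (Pre ++ a ∷ Post) → Independent (Pre ++ Post)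
  independent-remove []        Post (_ , Post-indep)     = Post-indep
  independent-remove (x ∷ Pre) Post (x-indep , rest-indep) =
    (λ k w w∈ → x-indep k w (span-mono (++⁺ʳ Pre (xs⊆x∷xs Post _)) w w∈))
    , independent-remove Pre Post rest-indep

  span-toList⁺ : ∀ {d} (a : Fin d → Carrier) (b : Fin d → Vec) →
                 span (Vector.toList b) ∋ lincomb a b
  span-toList⁺ {zero}  a b = zero∈ (span [])
  span-toList⁺ {suc d} a b =
    +-closed (span L) (·-closed (span L) (a fzero) (span-∋ L (here ≡.refl)))
                      (span-mono (xs⊆x∷xs L′ (b fzero)) _ (span-toList⁺ (a ∘ fsuc) (b ∘ fsuc)))
    where
    L = Vector.toList b
    L′ = Vector.toList (b ∘ fsuc)

  span-toList⁻ : ∀ {d} (b : Fin d → Vec) {w} →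
                 span (Vector.toList b) ∋ w → ∃[ a ] (w ≈ᵥ lincomb a b)
  span-toList⁻ {zero}  b (a , w≈) = a , w≈
  span-toList⁻ {suc d} b (a , w≈) =
    let a′ , rest≈ = span-toList⁻ (b ∘ fsuc) (a ∘ fsuc , λ i → refl)
    in (a fzero Vector.∷ a′) , λ i → trans (w≈ i) (+-congˡ (rest≈ i))

  independent-toList : ∀ {d} (b : Fin d → Vec) → LinIndep b → Independent (Vector.toList b)
  independent-toList {zero}  b b-indep = tt
  independent-toList {suc d} b b-indep = head-indep , independent-toList (b ∘ fsuc) tail-indep
    where
    head-indep : ∀ k w → span (Vector.toList (b ∘ fsuc)) ∋ w →
                 ((k ·ᵥ b fzero) +ᵥ w) ≈ᵥ 0ᵥ → k ≈ 0#
    head-indep k w w∈ kb+w≈0 =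
      let a , w≈ = span-toList⁻ (b ∘ fsuc) w∈
      in b-indep (k Vector.∷ a) (λ i → trans (+-congˡ (sym (w≈ i))) (kb+w≈0 i)) fzero
    tail-indep : LinIndep (b ∘ fsuc)
    tail-indep a Σ≈0 i =
      b-indep (0# Vector.∷ a) (λ j → trans (+-cong (zeroˡ _) (Σ≈0 j)) (+-identityˡ 0#)) (fsuc i)

  module Closure (cl : Subspace → Subspace) (isClosure : IsClosure cl) where
    open IsClosure isClosure

    clSpan : List Vec → Subspace
    clSpan L = cl (span L)

    cl-least : ∀ A B → A ⊆ cl B → cl A ⊆ cl B
    cl-least A B A⊆clB v v∈ = proj₁ (Cl3 B) v (Cl2 A (cl B) A⊆clB v v∈)

    clSpan-least : ∀ L M → All (clSpan M ∋_) L → clSpan L ⊆ clSpan M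
    clSpan-least L M L⊆ = cl-least (span L) (span M) (span-least (clSpan M) L⊆)

    clSpan-mono : ∀ {L M} → L ⊆ˡ M → clSpan L ⊆ clSpan M
    clSpan-mono {L} {M} L⊆M = Cl2 (span L) (span M) (span-mono L⊆M)

    ⊆ˡ⇒clSpan : ∀ L M → L ⊆ˡ M → All (clSpan M ∋_) L
    ⊆ˡ⇒clSpan L M L⊆M = All.tabulate (λ x∈L → Cl1 (span M) _ (span-∋ M (L⊆M x∈L)))

    exchange : ∀ B {a j} → Nonzero a → Nonzero j →
               ¬ (clSpan B ∋ a) → clSpan (B ++ [ j ]) ∋ a → clSpan (a ∷ B) ∋ j
    exchange B {a} {j} a≉0 j≉0 a∉B a∈Bj =
      Cl2 (span B ⊕ line a) (span (a ∷ B))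
          (⊕-least {span B} {line a} {span (a ∷ B)} (span-mono (xs⊆x∷xs B a))
                   (span-mono {[ a ]} {a ∷ B} (∷⁺ʳ a λ ())))
          j (Cl4 (span B) (line j) (line a) (line-hasDim j≉0) (line-hasDim a≉0)
                 line-a⊆ line-a⊈ j (span-∋ [ j ] (here ≡.refl)))
      where
      line-a⊆ : line a ⊆ cl (span B ⊕ line j)
      line-a⊆ = span-least (cl (span B ⊕ line j))
                  (Cl2 (span (B ++ [ j ])) (span B ⊕ line j) (span-++ B [ j ]) a a∈Bj ∷ [])
      line-a⊈ : ¬ (line a ⊆ clSpan B)
      line-a⊈ a⊆ = a∉B (a⊆ a (span-∋ [ a ] (here ≡.refl)))

    clSpan-exchange : ∀ D R₁ {j} R₂ {a} → Nonzero a → Nonzero j →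
                      ¬ (clSpan (D ++ R₁) ∋ a) → clSpan (D ++ R₁ ++ [ j ]) ∋ a →
                      clSpan (D ++ R₁ ++ j ∷ R₂) ⊆ clSpan (a ∷ D ++ R₁ ++ R₂)
    clSpan-exchange D R₁ {j} R₂ {a} a≉0 j≉0 a∉ a∈ =
      clSpan-least (D ++ R₁ ++ j ∷ R₂) M
        (++⁺ (⊆ˡ⇒clSpan D M (there ∘ xs⊆xs++ys D (R₁ ++ R₂)))
             (++⁺ (⊆ˡ⇒clSpan R₁ M (there ∘ xs⊆ys++xs (R₁ ++ R₂) D ∘ xs⊆xs++ys R₁ R₂))
                  (j∈ ∷ ⊆ˡ⇒clSpan R₂ M (there ∘ xs⊆ys++xs (R₁ ++ R₂) D ∘ xs⊆ys++xs R₂ R₁))))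
      where
      M = a ∷ D ++ R₁ ++ R₂
      j∈ : clSpan M ∋ j
      j∈ = clSpan-mono (∷⁺ʳ a (++⁺ʳ D (xs⊆xs++ys R₁ R₂))) j
             (exchange (D ++ R₁) a≉0 j≉0 a∉
               (≡.subst (λ L → clSpan L ∋ a) (≡.sym (++-assoc D R₁ [ j ])) a∈))

    exchange-step : ∀ D R {a} → All Nonzero R → Nonzero a →
                    ¬ (clSpan D ∋ a) → clSpan (D ++ R) ∋ a →
                    ¬ ¬ (∃[ R₁ ] ∃[ j ] ∃[ R₂ ]
                           (R ≡ R₁ ++ j ∷ R₂ × clSpan (D ++ R) ⊆ clSpan (a ∷ D ++ R₁ ++ R₂)))
    exchange-step D R {a} R≉0 a≉0 a∉D a∈DR = do
      (R₁ , j , R₂ , ≡.refl , a∉ , a∈) ←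
        ¬¬-first-prefix (λ L → clSpan (D ++ L) ∋ a) R
          (a∉D ∘ clSpan-mono (⊆-reflexive (++-identityʳ D)) a) a∈DR
      let j≉0 = All.lookup R≉0 (∈-++⁺ʳ R₁ (here ≡.refl))
      return (R₁ , j , R₂ , ≡.refl , clSpan-exchange D R₁ R₂ a≉0 j≉0 a∉ a∈)

    ClIndependent : List Vec → Set (c ⊔ ℓ)
    ClIndependent []      = ⊤
    ClIndependent (a ∷ T) = ¬ (clSpan T ∋ a) × ClIndependent T

    ∉-others⇒ClIndependent : ∀ L → (∀ Pre a Post → L ≡ Pre ++ a ∷ Post →
                                      ¬ (clSpan (Pre ++ Post) ∋ a)) → ClIndependent L
    ∉-others⇒ClIndependent []      _       = tt
    ∉-others⇒ClIndependent (a ∷ T) ∉others =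
      ∉others [] a T ≡.refl ,
      ∉-others⇒ClIndependent T λ Pre b Post T≡ b∈ →
        ∉others (a ∷ Pre) b Post (≡.cong (a ∷_) T≡) (clSpan-mono (xs⊆x∷xs (Pre ++ Post) a) b b∈)

    steinitz : ∀ T R → All Nonzero T → All Nonzero R → ClIndependent T → All (clSpan R ∋_) T →
               ¬ ¬ (∃[ X ] (All (_∈ R) X × length T +ℕ length X ≡ length R
                             × clSpan R ⊆ clSpan (T ++ X)))
    steinitz []      R _ _ _ _ = return (R , All.tabulate (λ x∈ → x∈) , ≡.refl , λ _ v∈ → v∈)
    steinitz (a ∷ T) R (a≉0 ∷ T≉0) R≉0 (a∉T , T-indep) (a∈R ∷ T⊆R) = do
      (X′ , X′⊆R , |T|+|X′| , R⊆TX′) ← steinitz T R T≉0 R≉0 T-indep T⊆R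
      (X₁ , j , X₂ , ≡.refl , TX′⊆) ←
        exchange-step T X′ (All.map (All.lookup R≉0) X′⊆R) a≉0 a∉T (R⊆TX′ a a∈R)
      return ( X₁ ++ X₂
             , anti-mono (++⁺ʳ X₁ (xs⊆x∷xs X₂ j)) X′⊆R
             , ≡.trans (≡.sym (ℕ.+-suc (length T) _))
                       (≡.trans (≡.cong (length T +ℕ_) (≡.sym (length-++-∷ X₁ X₂))) |T|+|X′|)
             , λ v v∈ → TX′⊆ v (R⊆TX′ v v∈) )

    module Rank (r : Subspace → ℕ) (isRank : ∀ A → IsRankCl cl A (r A)) where

      rank-≤-independent : ∀ S L → All (S ∋_) L → S ⊆ clSpan L → Independent L → r S ≤ℕ length L
      rank-≤-independent S L L⊆S S⊆L L-indep =
        proj₂ (isRank S) (span L) (length L) L⊆S′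
              (Cl2 (span L) S L⊆S′ , cl-least S (span L) S⊆L) (span-hasDim L L-indep)
        where
        L⊆S′ : span L ⊆ S
        L⊆S′ = span-least S L⊆S

      rank-clIndependent : ∀ S L → All (S ∋_) L → S ⊆ clSpan L → Independent L →
                           length L ≡ r S → ClIndependent L
      rank-clIndependent S L L⊆S S⊆L L-indep |L|≡r = ∉-others⇒ClIndependent L ∉others
        where
        ∉others : ∀ Pre a Post → L ≡ Pre ++ a ∷ Post → ¬ (clSpan (Pre ++ Post) ∋ a)
        ∉others Pre a Post ≡.refl a∈ = ℕ.1+n≰n (≡.subst (_≤ℕ length (Pre ++ Post)) r≡ shorter)
          where
          drop-a : Pre ++ Post ⊆ˡ Pre ++ a ∷ Post
          drop-a = ++⁺ʳ Pre (xs⊆x∷xs Post a)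
          shorter : r S ≤ℕ length (Pre ++ Post)
          shorter = rank-≤-independent S (Pre ++ Post) (anti-mono drop-a L⊆S)
            (λ v v∈ → clSpan-least (Pre ++ a ∷ Post) (Pre ++ Post)
                        (++⁺ (⊆ˡ⇒clSpan Pre (Pre ++ Post) (xs⊆xs++ys Pre Post))
                             (a∈ ∷ ⊆ˡ⇒clSpan Post (Pre ++ Post) (xs⊆ys++xs Post Pre)))
                        v (S⊆L v v∈))
            (independent-remove Pre Post L-indep)
          r≡ : r S ≡ suc (length (Pre ++ Post))
          r≡ = ≡.trans (≡.sym |L|≡r) (length-++-∷ Pre Post)

      record MinimalGenerators (S : Subspace) : Set (c ⊔ ℓ) where
        field
          gens          : List Vec
          gens⊆         : All (S ∋_) gens
          nonzero       : All Nonzero gens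
          clIndependent : ClIndependent gens
          generates     : S ⊆ clSpan gens
          length≡rank   : length gens ≡ r S

      basis⇒minimalGenerators : ∀ S I → I ⊆ S → cl I ≐ cl S → HasDim I (r S) →
                                MinimalGenerators S
      basis⇒minimalGenerators S I I⊆S clI≐clS (b , b∈I , b-indep , b-spans) = record
        { gens          = L
        ; gens⊆         = L⊆S
        ; nonzero       = independent-nonzero L L-indep
        ; clIndependent = rank-clIndependent S L L⊆S S⊆L L-indep (length-tabulate b)
        ; generates     = S⊆L
        ; length≡rank   = length-tabulate b
        }
        where
        L = Vector.toList b
        L⊆S : All (S ∋_) L
        L⊆S = tabulate⁺ (λ i → I⊆S _ (b∈I i))
        L-indep : Independent L
        L-indep = independent-toList b b-indep
        I⊆L : I ⊆ span L
        I⊆L v v∈ = let a , v≈ = b-spans v v∈ in resp (span L) (symᵥ v≈) (span-toList⁺ a b)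
        S⊆L : S ⊆ clSpan L
        S⊆L v v∈ = Cl2 I (span L) I⊆L v (proj₂ clI≐clS v (Cl1 S v v∈))

      minimalGenerators : ∀ S → MinimalGenerators S
      minimalGenerators S =
        let I , I⊆S , clI≐clS , I-dim = proj₁ (isRank S)
        in basis⇒minimalGenerators S I I⊆S clI≐clS I-dim

      extend : ∀ S T → All Nonzero T → ClIndependent T → All (S ∋_) T →
               ¬ ¬ (∃[ X ] (All Nonzero X × length T +ℕ length X ≡ r S × S ⊆ clSpan (T ++ X)))
      extend S T T≉0 T-indep T⊆S = do
        (X , X⊆gens , |T|+|X| , gens⊆TX) ←
          steinitz T gens T≉0 nonzero T-indep (All.map (λ {v} v∈ → generates v v∈) T⊆S)
        return (X , All.map (All.lookup nonzero) X⊆gens , ≡.trans |T|+|X| length≡rank ,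
                λ v v∈ → gens⊆TX v (generates v v∈))
        where open MinimalGenerators (minimalGenerators S)

      rank-≤-length : ∀ S L → S ⊆ clSpan L → All Nonzero L → r S ≤ℕ length L
      rank-≤-length S L S⊆L L≉0 = decidable-stable (r S ℕ.≤? length L) do
        (X , _ , |gens|+|X| , _) ←
          steinitz gens L nonzero L≉0 clIndependent (All.map (λ {v} v∈ → S⊆L v v∈) gens⊆)
        return (≡.subst₂ _≤ℕ_ length≡rank |gens|+|X| (ℕ.m≤m+n (length gens) (length X)))
        where open MinimalGenerators (minimalGenerators S)

      rank-≤-dim : R1 r
      rank-≤-dim A d A-dim =
        proj₂ (isRank A) A d (λ _ v∈ → v∈) ((λ _ v∈ → v∈) , (λ _ v∈ → v∈)) A-dim

      rank-mono : R2 r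
      rank-mono A B A⊆B =
        ≡.subst (r A ≤ℕ_) length≡rank
                (rank-≤-length A gens (λ v v∈ → generates v (A⊆B v v∈)) nonzero)
        where open MinimalGenerators (minimalGenerators B)

      rank-submodular : R3 r
      rank-submodular A B = decidable-stable (_ ℕ.≤? _) do
        (X , X≉0 , |P|+|X|≡rA , A⊆PX) ← extend A gens nonzero clIndependent (All.map proj₁ gens⊆)
        (Y , Y≉0 , |P|+|Y|≡rB , B⊆PY) ← extend B gens nonzero clIndependent (All.map proj₂ gens⊆)
        let A⊕B⊆PXY : (A ⊕ B) ⊆ clSpan (gens ++ X ++ Y)
            A⊕B⊆PXY = ⊕-least {A} {B} {clSpan (gens ++ X ++ Y)}
                        (λ v → clSpan-mono (++⁺ʳ gens (xs⊆xs++ys X Y)) v ∘ A⊆PX v)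
                        (λ v → clSpan-mono (++⁺ʳ gens (xs⊆ys++xs Y X)) v ∘ B⊆PY v)
            r⊕≤ = rank-≤-length (A ⊕ B) (gens ++ X ++ Y) A⊕B⊆PXY (++⁺ nonzero (++⁺ X≉0 Y≉0))
        return (ℕ.≤-trans (ℕ.+-mono-≤ r⊕≤ (ℕ.≤-reflexive (≡.sym length≡rank)))
                          (ℕ.≤-reflexive (count X Y |P|+|X|≡rA |P|+|Y|≡rB)))
        where
        open MinimalGenerators (minimalGenerators (A ∩ B))
        count : ∀ X Y → length gens +ℕ length X ≡ r A → length gens +ℕ length Y ≡ r B →
                length (gens ++ X ++ Y) +ℕ length gens ≡ r A +ℕ r B
        count X Y ≡rA ≡rB = begin
          length (gens ++ X ++ Y) +ℕ length gens
            ≡⟨ ≡.cong (_+ℕ length gens) (≡.trans (length-++ gens)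
                                                 (≡.cong (length gens +ℕ_) (length-++ X))) ⟩
          (length gens +ℕ (length X +ℕ length Y)) +ℕ length gens
            ≡⟨ counted-twice (length gens) (length X) (length Y) ⟩
          (length gens +ℕ length X) +ℕ (length gens +ℕ length Y)
            ≡⟨ ≡.cong₂ _+ℕ_ ≡rA ≡rB ⟩
          r A +ℕ r B ∎
          where open ≡.≡-Reasoning

theorem51 : {c ℓ : Level} (K : Field c ℓ) (n : ℕ) →
    let open VectorSpace K n in
    (cl : Subspace → Subspace) → IsClosure cl →
    (r : Subspace → ℕ) → (∀ A → IsRankCl cl A (r A)) →
    R1 r × R2 r × R3 r
theorem51 K n cl isClosure r isRank = rank-≤-dim , rank-mono , rank-submodular
  where open Span.Closure.Rank K n cl isClosure r isRank
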